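{- Let $H$ be a nontrivial connected graph with $diam(H)\geq2$. (1) If $H$ is nonbipartite, then $spvc(K_2\times H)=2$. (2) Let $n\geq4$. If $diam(H)=2$ and every edge of $H$ is contained in a triangle of $H$, then $spvc(K_n\times H)=1$; otherwise $spvc(K_n\times H)=2$. (3) If $diam(H)=2$ and every edge of $H$ is contained in a triangle of $H$, then $spvc(K_3\times H)=1$; otherwise $spvc(K_3\times H)=2$ when $H$ is a tree, and $2\leq spvc(K_3\times H)\leq3$ when $H$ is not a tree.
   Context: All graphs are simple, finite and undirected; nontrivial means having at least two vertices; $K_n$ is the complete graph on $n$ vertices. The direct product $G\times H$ has vertex set $V(G)\times V(H)$, with $(g,h)$ adjacent to $(g',h')$ iff $gg'\in E(G)$ and $hh'\in E(H)$. In a vertex-colored graph, a path is vertex-proper if any two adjacent internal vertices of the path receive different colors. A $u$-$v$ geodesic is a $u$-$v$ path of length $d(u,v)$; $spvc(G)$ is the smallest number of colors in a vertex-coloring of a connected graph $G$ such that any two vertices $u,v$ are joined by a vertex-proper $u$-$v$ geodesic, with $spvc(G)=0$ for complete $G$. -}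

module Defs where

open import Data.Nat using (ℕ; zero; suc; _+_; _*_; _≤_; _<_)
open import Data.Fin using (Fin; remQuot)
open import Data.Product using (Σ; ∃; _×_; _,_; proj₁; proj₂)
open import Data.Sum using (_⊎_)
open import Relation.Nullary using (¬_)
open import Relation.Binary.PropositionalEquality using (_≡_; _≢_; refl) renaming (sym to ≡-sym)

record Graph : Set₁ where
  field
    size   : ℕ
    Adj    : Fin size → Fin size → Set
    sym    : ∀ {u v} → Adj u v → Adj v u
    irrefl : ∀ {u} → ¬ Adj u u
open Graph public

K : ℕ → Graph
K n = record { size = n ; Adj = λ i j → i ≢ j
             ; sym = λ p q → p (≡-sym q)
             ; irrefl = λ p → p refl }

_×ᴳ_ : Graph → Graph → Graph
G ×ᴳ H = record
  { size = size G * size H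
  ; Adj = λ x y → Adj G (proj₁ (rq x)) (proj₁ (rq y)) × Adj H (proj₂ (rq x)) (proj₂ (rq y))
  ; sym = λ p → Graph.sym G (proj₁ p) , Graph.sym H (proj₂ p)
  ; irrefl = λ p → Graph.irrefl G (proj₁ p)
  }
  where
  rq : Fin (size G * size H) → Fin (size G) × Fin (size H)
  rq = remQuot {size G} (size H)

module _ (G : Graph) where

  record Path (u v : Fin (size G)) (L : ℕ) : Set where
    field
      vert  : ℕ → Fin (size G)
      start : vert 0 ≡ u
      end   : vert L ≡ v
      step  : ∀ i → i < L → Adj G (vert i) (vert (suc i))
      inj   : ∀ i j → i ≤ L → j ≤ L → vert i ≡ vert j → i ≡ j
  open Path public

  Connected : Set
  Connected = ∀ u v → ∃ λ L → Path u v L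

  Dist : Fin (size G) → Fin (size G) → ℕ → Set
  Dist u v d = Path u v d × (∀ L → Path u v L → d ≤ L)

  Diam : ℕ → Set
  Diam D = (∀ u v → ∃ λ d → Dist u v d × d ≤ D)
         × (∃ λ u → ∃ λ v → Dist u v D)

  Complete : Set
  Complete = ∀ u v → u ≢ v → Adj G u v

  Geodesic : Fin (size G) → Fin (size G) → ℕ → Set
  Geodesic u v L = Σ (Path u v L) λ _ → Dist u v L

  VertexProper : ∀ {k u v L} → (Fin (size G) → Fin k) → Path u v L → Set
  VertexProper {L = L} c p =
    ∀ i → 1 ≤ i → suc i < L → c (vert p i) ≢ c (vert p (suc i))

  SPVColoring : ∀ {k} → (Fin (size G) → Fin k) → Set
  SPVColoring c = ∀ u v → ∃ λ L → Σ (Path u v L) λ p → Dist u v L × VertexProper c p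

  SPVColorable : ℕ → Set
  SPVColorable k = Σ (Fin (size G) → Fin k) SPVColoring

  IsSpvc : ℕ → Set
  IsSpvc k = (Complete × k ≡ 0)
           ⊎ (¬ Complete × SPVColorable k × (∀ j → j < k → ¬ SPVColorable j))

  NonBipartite : Set
  NonBipartite = ¬ (Σ (Fin (size G) → Fin 2) λ c → ∀ u v → Adj G u v → c u ≢ c v)

  EveryEdgeInTriangle : Set
  EveryEdgeInTriangle = ∀ u v → Adj G u v → ∃ λ w → Adj G u w × Adj G v w

  -- a cycle of length L ≥ 3: distinct vertices p 0..p (L-1), consecutive adjacent,
  -- p (L-1) adjacent to p 0 (written with L = suc m)
  HasCycle : Set
  HasCycle = ∃ λ m → 2 ≤ m × Σ (ℕ → Fin (size G)) λ p →
               (∀ i → i < m → Adj G (p i) (p (suc i)))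
             × Adj G (p m) (p 0)
             × (∀ i j → i ≤ m → j ≤ m → p i ≡ p j → i ≡ j)

  Tree : Set
  Tree = Connected × ¬ HasCycle

{-# OPTIONS --safe #-}
-- Lower bounds: K n × H is never complete, and unless diam H = 2 and every edge of H lies in a
-- triangle it has two vertices at distance at least 3, so the interior of every geodesic between
-- them contains two adjacent vertices and one colour is not enough. In K₂ × H such a pair is
-- (0, u), (1, v) with d(u, v) ≥ 2, because the K₂-coordinate alternates along every walk.
--
-- Upper bounds: under a proper colouring every geodesic is vertex-proper. Colouring by the
-- K n-coordinate is proper, and so is colouring (i, h) by the parity of the length of a fixed
-- walk from a root to h when H has no odd closed walk, e.g. when H is a tree (an odd closed walk
-- contains an odd cycle). K₂ × H is connected because a nonbipartite H has an odd closed walk at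
-- every vertex, which flips the K₂-coordinate. If diam H = 2 and every edge lies in a triangle,
-- any two vertices of K n × H (n ≥ 3) are joined by a walk of length 2, so one colour suffices.
-- For n ≥ 4, colour (i, h) by whether i ≤ 1: every geodesic of length at least 3 can be rerouted
-- over the same H-vertices with K n-coordinates whose classes alternate on the interior. For
-- K₃ × H the value, 2 or 3, is settled by exhaustive search: strong proper colourability of a
-- finite graph is decidable.

module Submission where

open import Data.Fin using (Fin; zero; suc; remQuot; combine; punchIn)
open import Data.Fin.Properties
  using (any?; all?; remQuot-combine; combine-remQuot; punchInᵢ≢i)
  renaming (_≟_ to _≟ᶠ_)
open import Data.Nat using (ℕ; zero; suc; _+_; _∸_; _≤_; _<_; z≤n; s≤s; _≤?_; parity)
open import Data.Nat.Induction using (<-rec)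
open import Data.Nat.Properties
open import Data.Parity.Base using (Parity; 0ℙ; 1ℙ; _⁻¹) renaming (_+_ to _+ℙ_)
open import Data.Parity.Properties
  using (suc-homo-⁻¹; +-homo-+; ⁻¹-selfInverse; p+p⁻¹≡1ℙ)
  renaming (_≟_ to _≟ℙ_; +-identityʳ to +ℙ-identityʳ)
open import Data.Product using (Σ; ∃; ∃₂; _×_; _,_; proj₁; proj₂)
open import Data.Sum using (_⊎_; inj₁; inj₂)
open import Data.Vec.Functional using (_∷_; head; tail)
open import Function using (_∘_)
open import Relation.Binary.Definitions using (tri<; tri≈; tri>)
open import Relation.Binary.PropositionalEquality
  using (_≡_; _≢_; refl; trans; cong; cong₂; subst; subst₂; module ≡-Reasoning)
  renaming (sym to ≡-sym)
open import Relation.Nullary using (¬_; Dec; yes; no; contradiction)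
open import Relation.Nullary.Decidable using (map′; _×-dec_; _→-dec_; ¬?; decidable-stable)

open import Defs

private variable
  G H : Graph
  k d i j L M : ℕ

module _ {P : ℕ → Set} (P? : ∀ n → Dec (P n)) where

  Least : ℕ → Set
  Least m = P m × (∀ {j} → P j → m ≤ j)

  least-witness : ∀ {n} → P n → ∃ Least
  least-witness {n} = <-rec (λ n → P n → ∃ Least) search n
    where
    search : ∀ n → (∀ {m} → m < n → P m → ∃ Least) → P n → ∃ Least
    search n smaller pn with anyUpTo? P? n
    ... | yes (m , m<n , pm) = smaller m<n pm
    ... | no none = n , pn , λ pj → ≮⇒≥ λ j<n → none (_ , j<n , pj)

shortcut-shorter : i < j → j ≤ L → i + (L ∸ j) < L
shortcut-shorter {i = i} {j = j} {L = L} i<j j≤L =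
  subst (i + (L ∸ j) <_) (m+[n∸m]≡n j≤L) (+-monoˡ-< (L ∸ j) i<j)

split-length : i ≤ j → j ≤ L → (j ∸ i) + (i + (L ∸ j)) ≡ L
split-length {i} {j} {L} i≤j j≤L = begin
  (j ∸ i) + (i + (L ∸ j))   ≡⟨ ≡-sym (+-assoc (j ∸ i) i (L ∸ j)) ⟩
  (j ∸ i) + i + (L ∸ j)     ≡⟨ cong (_+ (L ∸ j)) (m∸n+n≡m i≤j) ⟩
  j + (L ∸ j)               ≡⟨ m+[n∸m]≡n j≤L ⟩
  L                         ∎
  where open ≡-Reasoning

module _ (G : Graph) where

  record Walk (u v : Fin (size G)) (L : ℕ) : Set where
    constructor walk
    field
      vertex : ℕ → Fin (size G)
      first  : vertex 0 ≡ u
      last   : vertex L ≡ v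
      edge   : ∀ i → i < L → Adj G (vertex i) (vertex (suc i))
  open Walk public

  WalkConnected : Set
  WalkConnected = ∀ u v → ∃ λ L → Walk u v L

module _ {G : Graph} where

  private variable
    u v w x : Fin (size G)

  path⇒walk : Path G u v L → Walk G u v L
  path⇒walk p = walk (vert p) (start p) (end p) (step p)

  cast : u ≡ x → v ≡ w → Walk G u v L → Walk G x w L
  cast refl refl t = t

  stay : ∀ u → Walk G u u 0
  stay u = walk (λ _ → u) refl refl (λ _ ())

  infixr 5 _◅_ _++_

  _◅_ : Adj G u w → Walk G w v L → Walk G u v (suc L)
  _◅_ {u = u} {L = L} a t = walk vertex′ refl (last t) edge′
    where
    vertex′ : ℕ → Fin (size G)
    vertex′ zero = u
    vertex′ (suc i) = vertex t i
    edge′ : ∀ i → i < suc L → Adj G (vertex′ i) (vertex′ (suc i))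
    edge′ zero _ = subst (Adj G u) (≡-sym (first t)) a
    edge′ (suc i) (s≤s i<L) = edge t i i<L

  uncons : Walk G u v (suc L) → ∃ λ w → Adj G u w × Walk G w v L
  uncons t = vertex t 1 , subst (λ z → Adj G z (vertex t 1)) (first t) (edge t 0 (s≤s z≤n))
           , walk (λ i → vertex t (suc i)) refl (last t)
                  (λ i i<L → edge t (suc i) (s≤s i<L))

  _++_ : Walk G u w L → Walk G w v M → Walk G u v (L + M)
  _++_ {L = zero} s t = cast (trans (≡-sym (last s)) (first s)) refl t
  _++_ {L = suc L} s t with uncons s
  ... | _ , a , s′ = a ◅ (s′ ++ t)

  take : (t : Walk G u v L) → i ≤ L → Walk G u (vertex t i) i
  take t i≤L = walk (vertex t) (first t) refl (λ j j<i → edge t j (<-≤-trans j<i i≤L))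

  drop : (t : Walk G u v L) → i ≤ L → Walk G (vertex t i) v (L ∸ i)
  drop {L = L} {i = i} t i≤L =
    walk (λ j → vertex t (i + j)) (cong (vertex t) (+-identityʳ i))
         (trans (cong (vertex t) (m+[n∸m]≡n i≤L)) (last t)) edge′
    where
    edge′ : ∀ j → j < L ∸ i → Adj G (vertex t (i + j)) (vertex t (i + suc j))
    edge′ j j<L∸i = subst (λ z → Adj G (vertex t (i + j)) (vertex t z)) (≡-sym (+-suc i j))
      (edge t (i + j) (subst (i + j <_) (m+[n∸m]≡n i≤L) (+-monoʳ-< i j<L∸i)))

  reverse : Walk G u v L → Walk G v u L
  reverse {L = L} t = walk (λ i → vertex t (L ∸ i)) (last t)
    (trans (cong (vertex t) (n∸n≡0 L)) (first t)) edge′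
    where
    edge′ : ∀ i → i < L → Adj G (vertex t (L ∸ i)) (vertex t (L ∸ suc i))
    edge′ i i<L = Graph.sym G (subst (λ z → Adj G (vertex t (L ∸ suc i)) (vertex t z))
      (≡-sym (+-∸-assoc 1 i<L)) (edge t (L ∸ suc i) (∸-monoʳ-< (s≤s z≤n) i<L)))

  shortcut : (t : Walk G u v L) → i < j → j ≤ L → vertex t i ≡ vertex t j →
             Walk G u v (i + (L ∸ j))
  shortcut t i<j j≤L eq =
    take t (≤-trans (<⇒≤ i<j) j≤L) ++ cast (≡-sym eq) refl (drop t j≤L)

  detour : (t : Walk G u v L) → i ≤ j → j ≤ L → vertex t i ≡ vertex t j →
           Walk G (vertex t i) (vertex t i) (j ∸ i)
  detour t i≤j j≤L eq = cast refl (≡-sym eq) (drop (take t j≤L) i≤j)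

  shortest⇒path : (t : Walk G u v L) → (∀ {k} → Walk G u v k → L ≤ k) → Path G u v L
  shortest⇒path {L = L} t shortest =
    record { vert = vertex t ; start = first t ; end = last t ; step = edge t ; inj = injective }
    where
    no-repeat : i < j → j ≤ L → vertex t i ≢ vertex t j
    no-repeat i<j j≤L eq =
      <⇒≱ (shortcut-shorter i<j j≤L) (shortest (shortcut t i<j j≤L eq))
    injective : ∀ i j → i ≤ L → j ≤ L → vertex t i ≡ vertex t j → i ≡ j
    injective i j i≤L j≤L eq with <-cmp i j
    ... | tri< i<j _ _ = contradiction eq (no-repeat i<j j≤L)
    ... | tri≈ _ i≡j _ = i≡j
    ... | tri> _ _ j<i = contradiction (≡-sym eq) (no-repeat j<i i≤L)

module _ {G : Graph} where

  private variable
    u v : Fin (size G)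

  walk₀⇒≡ : Walk G u v 0 → u ≡ v
  walk₀⇒≡ t = trans (≡-sym (first t)) (last t)

  walk₁⇒adj : Walk G u v 1 → Adj G u v
  walk₁⇒adj t = subst₂ (Adj G) (first t) (last t) (edge t 0 (s≤s z≤n))

  walk₂⇒middle : Walk G u v 2 → ∃ λ w → Adj G u w × Adj G w v
  walk₂⇒middle t with uncons t
  ... | w , a , t′ = w , a , walk₁⇒adj t′

  edge-path : Adj G u v → Path G u v 1
  edge-path {u} {v} a = shortest⇒path (a ◅ stay v) nonempty
    where
    nonempty : Walk G u v k → 1 ≤ k
    nonempty {zero} t = contradiction (subst (Adj G u) (≡-sym (walk₀⇒≡ t)) a) (irrefl G)
    nonempty {suc _} _ = s≤s z≤n

  dist-unique : ∀ {d′} → Dist G u v d → Dist G u v d′ → d ≡ d′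
  dist-unique (p , minimal) (q , minimal′) = ≤-antisym (minimal _ q) (minimal′ _ p)

  adjacent? : (∀ u v → ∃ (Dist G u v)) → ∀ u v → Dec (Adj G u v)
  adjacent? dist u v with dist u v
  ... | zero , p , _ =
    no λ a → irrefl G (subst (Adj G u) (≡-sym (walk₀⇒≡ (path⇒walk p))) a)
  ... | suc zero , p , _ = yes (walk₁⇒adj (path⇒walk p))
  ... | suc (suc _) , _ , minimal =
    no λ a → contradiction (minimal 1 (edge-path a)) λ { (s≤s ()) }

connected⇒walk-connected : Connected G → WalkConnected G
connected⇒walk-connected connected u v = let (L , p) = connected u v in L , path⇒walk p

neighbour : 2 ≤ size G → Connected G → ∀ h → ∃ (Adj G h)
neighbour (s≤s (s≤s _)) connected h with connected h (punchIn h zero)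
... | zero , p = contradiction (≡-sym (walk₀⇒≡ (path⇒walk p))) (punchInᵢ≢i h zero)
... | suc _ , p = let (w , a , _) = uncons (path⇒walk p) in w , a

module _ {G : Graph} (c : Fin (size G) → Fin k) where

  ProperInterior : ∀ {u v} → Walk G u v L → Set
  ProperInterior {L = L} t =
    ∀ i → 1 ≤ i → suc i < L → c (vertex t i) ≢ c (vertex t (suc i))

  short⇒proper-interior : ∀ {u v} → L ≤ 2 → (t : Walk G u v L) → ProperInterior t
  short⇒proper-interior L≤2 t (suc i) _ 2+i<L =
    contradiction (≤-trans 2+i<L L≤2) λ { (s≤s (s≤s ())) }

module _ {G : Graph} (adj? : ∀ u v → Dec (Adj G u v)) where

  private variable
    u v : Fin (size G)

  walk? : ∀ u v L → Dec (Walk G u v L)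
  walk? u v zero = map′ (λ { refl → stay u }) walk₀⇒≡ (u ≟ᶠ v)
  walk? u v (suc L) =
    map′ (λ (w , a , t) → a ◅ t) uncons (any? λ w → adj? u w ×-dec walk? w v L)

  shortest-walk : Walk G u v L →
                  ∃ λ d → Walk G u v d × (∀ {k} → Walk G u v k → d ≤ k)
  shortest-walk = least-witness (walk? _ _)

  distance : Walk G u v L → ∃ (Dist G u v)
  distance t with shortest-walk t
  ... | d , s , shortest = d , shortest⇒path s shortest , λ _ p → shortest (path⇒walk p)

  dist≤walk : Dist G u v d → Walk G u v L → d ≤ L
  dist≤walk (_ , minimal) t with shortest-walk t
  ... | _ , s , shortest = ≤-trans (minimal _ (shortest⇒path s shortest)) (shortest t)

  walk-at-distance⇒path : Dist G u v d → Walk G u v d → Path G u v d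
  walk-at-distance⇒path dist t = shortest⇒path t (dist≤walk dist)

  rerouting⇒spv : (c : Fin (size G) → Fin k) → WalkConnected G →
    (∀ {x y d} → Dist G x y d → 3 ≤ d → Σ (Walk G x y d) (ProperInterior c)) →
    SPVColoring G c
  rerouting⇒spv c connected reroute x y with distance (proj₂ (connected x y))
  ... | d , dist with 3 ≤? d
  ... | yes 3≤d = let (t , proper) = reroute dist 3≤d in
                  d , walk-at-distance⇒path dist t , dist , proper
  ... | no d≱3 = d , proj₁ dist , dist ,
                 short⇒proper-interior c (≤-pred (≰⇒> d≱3)) (path⇒walk (proj₁ dist))

  proper⇒spv : (c : Fin (size G) → Fin k) → WalkConnected G →
               (∀ x y → Adj G x y → c x ≢ c y) → SPVColoring G c
  proper⇒spv c connected proper = rerouting⇒spv c connected λ (p , _) _ →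
    path⇒walk p , λ i _ 1+i<d → proper _ _ (step p i (<-trans (n<1+n i) 1+i<d))

  short-walks⇒spv : (c : Fin (size G) → Fin k) →
                    (∀ x y → ∃ λ L → Walk G x y L × L ≤ 2) → SPVColoring G c
  short-walks⇒spv c short =
    rerouting⇒spv c (λ x y → let (L , t , _) = short x y in L , t) no-long-geodesic
    where
    no-long-geodesic : ∀ {x y d} → Dist G x y d → 3 ≤ d → Σ (Walk G x y d) (ProperInterior c)
    no-long-geodesic {x} {y} dist 3≤d = let (_ , t , L≤2) = short x y in
      contradiction (≤-trans (dist≤walk dist t) L≤2) (<⇒≱ 3≤d)

FarApart : (G : Graph) → Fin (size G) → Fin (size G) → Set
FarApart G x y = ∀ L → Path G x y L → 3 ≤ L

module _ {G : Graph} where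

  no-spv-0 : Fin (size G) → ¬ SPVColorable G 0
  no-spv-0 x (c , _) with c x
  ... | ()

  no-spv-1 : ∀ {x y} → FarApart G x y → ¬ SPVColorable G 1
  no-spv-1 {x} {y} far (c , spv) with spv x y
  ... | L , p , _ , proper = proper 1 ≤-refl (far L p) (one-colour _ _)
    where
    one-colour : (a b : Fin 1) → a ≡ b
    one-colour zero zero = refl

  below-2 : ∀ {x y} → FarApart G x y → j < 2 → ¬ SPVColorable G j
  below-2 {x = x} _ (s≤s z≤n) = no-spv-0 x
  below-2 far (s≤s (s≤s z≤n)) = no-spv-1 far

  isSpvc-1 : ¬ Complete G → Fin (size G) → SPVColorable G 1 → IsSpvc G 1
  isSpvc-1 incomplete x col =
    inj₂ (incomplete , col , λ { zero _ → no-spv-0 x ; (suc _) (s≤s ()) })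

  isSpvc-2 : ∀ {x y} → ¬ Complete G → FarApart G x y → SPVColorable G 2 → IsSpvc G 2
  isSpvc-2 incomplete far col = inj₂ (incomplete , col , λ _ → below-2 far)

  isSpvc-3 : ∀ {x y} → ¬ Complete G → FarApart G x y → ¬ SPVColorable G 2 →
             SPVColorable G 3 → IsSpvc G 3
  isSpvc-3 incomplete far no-2 col = inj₂ (incomplete , col , below-3)
    where
    below-3 : ∀ j → j < 3 → ¬ SPVColorable G j
    below-3 j j<3 with m≤n⇒m<n∨m≡n (≤-pred j<3)
    ... | inj₁ j<2 = below-2 far j<2
    ... | inj₂ refl = no-2

∃-function? : ∀ n (P : (Fin n → Fin k) → Set) →
              (∀ {f g} → (∀ i → f i ≡ g i) → P f → P g) → (∀ f → Dec (P f)) → Dec (∃ P)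
∃-function? zero P resp P? =
  map′ (λ p → empty , p) (λ (f , p) → resp (λ ()) p) (P? empty)
  where
  empty : Fin 0 → Fin k
  empty ()
∃-function? (suc n) P resp P? =
  map′ (λ (x , f , p) → x ∷ f , p) (λ (f , p) → head f , tail f , resp head∷tail p)
       (any? λ x → ∃-function? n (λ f → P (x ∷ f)) (λ f≗g → resp (cons-cong f≗g))
                                (λ f → P? (x ∷ f)))
  where
  head∷tail : ∀ {f : Fin (suc n) → Fin k} i → f i ≡ (head f ∷ tail f) i
  head∷tail zero = refl
  head∷tail (suc i) = refl
  cons-cong : ∀ {x} {f g : Fin n → Fin k} → (∀ i → f i ≡ g i) →
              ∀ i → (x ∷ f) i ≡ (x ∷ g) i
  cons-cong f≗g zero = refl
  cons-cong f≗g (suc i) = f≗g i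

module _ {G : Graph} (adj? : ∀ u v → Dec (Adj G u v)) (c : Fin (size G) → Fin k) where

  private variable
    u v : Fin (size G)

  -- The interior of a ◅ t is proper exactly when every edge of t but the last is.
  ProperExceptLast : Walk G u v L → Set
  ProperExceptLast {L = L} t = ∀ i → suc i < L → c (vertex t i) ≢ c (vertex t (suc i))

  proper-except-last? : ∀ u v L → Dec (Σ (Walk G u v L) ProperExceptLast)
  proper-except-last? u v zero = map′ (λ t → t , λ _ ()) proj₁ (walk? adj? u v 0)
  proper-except-last? u v (suc L) = map′ join split
    (any? λ w → adj? u w ×-dec ((1 ≤? L) →-dec ¬? (c u ≟ᶠ c w))
                         ×-dec proper-except-last? w v L)
    where
    join : (∃ λ w → Adj G u w × (1 ≤ L → c u ≢ c w) × Σ (Walk G w v L) ProperExceptLast) →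
           Σ (Walk G u v (suc L)) ProperExceptLast
    join (w , a , head-proper , t , tail-proper) = a ◅ t , proper
      where
      proper : ProperExceptLast (a ◅ t)
      proper zero 1<1+L e = head-proper (≤-pred 1<1+L) (trans e (cong c (first t)))
      proper (suc i) (s≤s 1+i<L) = tail-proper i 1+i<L
    split : Σ (Walk G u v (suc L)) ProperExceptLast →
            ∃ λ w → Adj G u w × (1 ≤ L → c u ≢ c w) × Σ (Walk G w v L) ProperExceptLast
    split (t , proper) = let (w , a , t′) = uncons t in
      w , a , (λ 1≤L e → proper 0 (s≤s 1≤L) (trans (cong c (first t)) e))
        , t′ , λ i 1+i<L → proper (suc i) (s≤s 1+i<L)

  proper-interior? : ∀ u v L → Dec (Σ (Walk G u v L) (ProperInterior c))
  proper-interior? u v zero = map′ (λ t → t , λ _ _ ()) proj₁ (walk? adj? u v 0)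
  proper-interior? u v (suc L) = map′ join split
    (any? λ w → adj? u w ×-dec proper-except-last? w v L)
    where
    join : (∃ λ w → Adj G u w × Σ (Walk G w v L) ProperExceptLast) →
           Σ (Walk G u v (suc L)) (ProperInterior c)
    join (w , a , t , proper) = a ◅ t , λ { (suc i) _ (s≤s 1+i<L) → proper i 1+i<L }
    split : Σ (Walk G u v (suc L)) (ProperInterior c) →
            ∃ λ w → Adj G u w × Σ (Walk G w v L) ProperExceptLast
    split (t , proper) = let (w , a , t′) = uncons t in
      w , a , t′ , λ i 1+i<L → proper (suc i) (s≤s z≤n) (s≤s 1+i<L)

  proper-geodesic? : Dist G u v d →
    Dec (∃ λ L → Σ (Path G u v L) λ p → Dist G u v L × VertexProper G c p)
  proper-geodesic? {u} {v} dist = map′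
    (λ (t , proper) → _ , walk-at-distance⇒path adj? dist t , dist , proper)
    (λ (L , p , dist′ , proper) → subst (λ L → Σ (Walk G u v L) (ProperInterior c))
                                        (dist-unique dist′ dist) (path⇒walk p , proper))
    (proper-interior? u v _)

  spv? : WalkConnected G → Dec (SPVColoring G c)
  spv? connected = all? λ u → all? λ v →
    proper-geodesic? (proj₂ (distance adj? (proj₂ (connected u v))))

spv-resp : ∀ {c c′ : Fin (size G) → Fin k} → (∀ x → c x ≡ c′ x) →
           SPVColoring G c → SPVColoring G c′
spv-resp c≗c′ spv x y with spv x y
... | L , p , dist , proper =
  L , p , dist , λ i 1≤i 1+i<L same →
    proper i 1≤i 1+i<L (trans (c≗c′ _) (trans same (≡-sym (c≗c′ _))))

spv-colourable? : (∀ u v → Dec (Adj G u v)) → WalkConnected G →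
                  ∀ k → Dec (SPVColorable G k)
spv-colourable? {G} adj? connected k =
  ∃-function? (size G) (SPVColoring G) spv-resp (λ c → spv? adj? c connected)

-- a ⊕ p is the vertex of K 2 reached from a by a walk whose length has parity p.
infixl 7 _⊕_

_⊕_ : Fin 2 → Parity → Fin 2
a ⊕ 0ℙ = a
zero ⊕ 1ℙ = suc zero
suc zero ⊕ 1ℙ = zero

⊕-⁻¹-≢ : ∀ a p → a ⊕ p ⁻¹ ≢ a ⊕ p
⊕-⁻¹-≢ zero 0ℙ ()
⊕-⁻¹-≢ zero 1ℙ ()
⊕-⁻¹-≢ (suc zero) 0ℙ ()
⊕-⁻¹-≢ (suc zero) 1ℙ ()

zero⊕-injective : ∀ {p q} → zero ⊕ p ≡ zero ⊕ q → p ≡ q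
zero⊕-injective {0ℙ} {0ℙ} _ = refl
zero⊕-injective {1ℙ} {1ℙ} _ = refl

fin2-≢-≢⇒≡ : ∀ {x y z : Fin 2} → x ≢ y → y ≢ z → x ≡ z
fin2-≢-≢⇒≡ {zero} {zero} x≢y _ = contradiction refl x≢y
fin2-≢-≢⇒≡ {zero} {suc zero} {zero} _ _ = refl
fin2-≢-≢⇒≡ {zero} {suc zero} {suc zero} _ y≢z = contradiction refl y≢z
fin2-≢-≢⇒≡ {suc zero} {zero} {zero} _ y≢z = contradiction refl y≢z
fin2-≢-≢⇒≡ {suc zero} {zero} {suc zero} _ _ = refl
fin2-≢-≢⇒≡ {suc zero} {suc zero} x≢y _ = contradiction refl x≢y

parity-suc : ∀ n → parity (suc n) ≡ parity n ⁻¹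
parity-suc n = ≡-sym (⁻¹-selfInverse (suc-homo-⁻¹ n))

OddClosedWalk : (G : Graph) → Fin (size G) → Set
OddClosedWalk G x = ∃ λ m → Walk G x x m × parity m ≡ 1ℙ

module _ {G : Graph} where

  private variable
    x h : Fin (size G)

  odd-closed-walk-transport : Walk G x h L → OddClosedWalk G x → OddClosedWalk G h
  odd-closed-walk-transport {L = L} t (m , loop , odd) =
    L + (m + L) , reverse t ++ loop ++ t , odd′
    where
    open ≡-Reasoning
    odd′ : parity (L + (m + L)) ≡ 1ℙ
    odd′ = begin
      parity (L + (m + L))                  ≡⟨ +-homo-+ L (m + L) ⟩
      parity L +ℙ parity (m + L)            ≡⟨ cong (parity L +ℙ_) (+-homo-+ m L) ⟩
      parity L +ℙ (parity m +ℙ parity L)    ≡⟨ cong (λ q → parity L +ℙ (q +ℙ parity L)) odd ⟩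
      parity L +ℙ parity L ⁻¹               ≡⟨ p+p⁻¹≡1ℙ (parity L) ⟩
      1ℙ                                    ∎

  distinct-closed-walk⇒cycle : ∀ {m} (t : Walk G x x m) →
    (∀ {i j} → i < j → j < m → vertex t i ≢ vertex t j) → parity m ≡ 1ℙ → HasCycle G
  distinct-closed-walk⇒cycle {m = 1} t _ _ = contradiction (walk₁⇒adj t) (irrefl G)
  distinct-closed-walk⇒cycle {m = suc (suc (suc n))} t distinct _ =
    suc (suc n) , s≤s (s≤s z≤n) , vertex t ,
    (λ i i<m → edge t i (m<n⇒m<1+n i<m)) ,
    subst (Adj G (vertex t (suc (suc n)))) (trans (last t) (≡-sym (first t)))
          (edge t _ ≤-refl) ,
    injective
    where
    injective : ∀ i j → i ≤ suc (suc n) → j ≤ suc (suc n) →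
                vertex t i ≡ vertex t j → i ≡ j
    injective i j i≤ j≤ eq with <-cmp i j
    ... | tri< i<j _ _ = contradiction eq (distinct i<j (s≤s j≤))
    ... | tri≈ _ i≡j _ = i≡j
    ... | tri> _ _ j<i = contradiction (≡-sym eq) (distinct j<i (s≤s i≤))

  -- At a repeated vertex the walk splits into two shorter closed walks, one of which is odd.
  odd-closed-walk⇒cycle : ∀ {m} → Walk G x x m → parity m ≡ 1ℙ → HasCycle G
  odd-closed-walk⇒cycle {m = m} = <-rec Goal shorten m
    where
    Goal : ℕ → Set
    Goal m = ∀ {x} → Walk G x x m → parity m ≡ 1ℙ → HasCycle G
    shorten : ∀ m → (∀ {m′} → m′ < m → Goal m′) → Goal m
    shorten m shorter t odd
      with anyUpTo? (λ j → anyUpTo? (λ i → vertex t i ≟ᶠ vertex t j) j) m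
    ... | no none =
      distinct-closed-walk⇒cycle t (λ i<j j<m eq → none (_ , j<m , _ , i<j , eq)) odd
    ... | yes (j , j<m , i , i<j , eq) with parity (i + (m ∸ j)) in outer-parity
    ...   | 1ℙ = shorter (shortcut-shorter i<j (<⇒≤ j<m)) (shortcut t i<j (<⇒≤ j<m) eq)
                         outer-parity
    ...   | 0ℙ = shorter (≤-<-trans (m∸n≤m j i) j<m) (detour t (<⇒≤ i<j) (<⇒≤ j<m) eq)
                         inner-odd
      where
      open ≡-Reasoning
      inner-odd : parity (j ∸ i) ≡ 1ℙ
      inner-odd = begin
        parity (j ∸ i)                          ≡⟨ ≡-sym (+ℙ-identityʳ _) ⟩
        parity (j ∸ i) +ℙ 0ℙ                    ≡⟨ cong (parity (j ∸ i) +ℙ_) (≡-sym outer-parity) ⟩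
        parity (j ∸ i) +ℙ parity (i + (m ∸ j))  ≡⟨ ≡-sym (+-homo-+ (j ∸ i) _) ⟩
        parity ((j ∸ i) + (i + (m ∸ j)))        ≡⟨ cong parity (split-length (<⇒≤ i<j) (<⇒≤ j<m)) ⟩
        parity m                                ≡⟨ odd ⟩
        1ℙ                                      ∎

-- Levels are parities of arbitrary walks from r: an edge between equal levels closes an odd walk.
module Levels {G : Graph} (adj? : ∀ u v → Dec (Adj G u v)) (connected : WalkConnected G)
              (r : Fin (size G)) where

  level : Fin (size G) → Parity
  level h = parity (proj₁ (connected r h))

  LevelsAlternate : Set
  LevelsAlternate = ∀ u v → Adj G u v → level u ≢ level v

  levels-alternate-or-odd-closed-walk : LevelsAlternate ⊎ OddClosedWalk G r
  levels-alternate-or-odd-closed-walk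
    with any? (λ u → any? λ v → adj? u v ×-dec (level u ≟ℙ level v))
  ... | no none = inj₁ λ u v a same → none (u , v , a , same)
  ... | yes (u , v , a , same) with connected r u | connected r v
  ...   | Lu , tu | Lv , tv = inj₂ (Lu + suc Lv , tu ++ a ◅ reverse tv , odd)
    where
    open ≡-Reasoning
    odd : parity (Lu + suc Lv) ≡ 1ℙ
    odd = begin
      parity (Lu + suc Lv)           ≡⟨ +-homo-+ Lu (suc Lv) ⟩
      parity Lu +ℙ parity (suc Lv)   ≡⟨ cong (parity Lu +ℙ_) (parity-suc Lv) ⟩
      parity Lu +ℙ parity Lv ⁻¹      ≡⟨ cong (λ q → parity Lu +ℙ q ⁻¹) (≡-sym same) ⟩
      parity Lu +ℙ parity Lu ⁻¹      ≡⟨ p+p⁻¹≡1ℙ (parity Lu) ⟩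
      1ℙ                             ∎

  level-colouring-proper : LevelsAlternate →
                           ∀ u v → Adj G u v → zero ⊕ level u ≢ zero ⊕ level v
  level-colouring-proper alternate u v a same = alternate u v a (zero⊕-injective same)

  acyclic⇒levels-alternate : ¬ HasCycle G → LevelsAlternate
  acyclic⇒levels-alternate acyclic with levels-alternate-or-odd-closed-walk
  ... | inj₁ alternate = alternate
  ... | inj₂ (_ , t , odd) = contradiction (odd-closed-walk⇒cycle t odd) acyclic

  nonbipartite⇒odd-closed-walk : NonBipartite G → OddClosedWalk G r
  nonbipartite⇒odd-closed-walk nonbipartite with levels-alternate-or-odd-closed-walk
  ... | inj₁ alternate = contradiction (_ , level-colouring-proper alternate) nonbipartite
  ... | inj₂ odd = odd

module _ {A : Set} where

  ProperSequence : A → A → ℕ → Set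
  ProperSequence a b L =
    Σ (ℕ → A) λ c → c 0 ≡ a × c L ≡ b × (∀ i → i < L → c i ≢ c (suc i))

  alternate : A → A → ℕ → A
  alternate x y zero = y
  alternate x y (suc i) = alternate y x i

  alternate-≢ : ∀ {x y} → x ≢ y → ∀ i → alternate x y i ≢ alternate x y (suc i)
  alternate-≢ x≢y zero = x≢y ∘ ≡-sym
  alternate-≢ x≢y (suc i) = alternate-≢ (x≢y ∘ ≡-sym) i

  alternate-≢-other : ∀ {x y b} → x ≢ b → y ≢ b → ∀ i → alternate x y i ≢ b
  alternate-≢-other x≢b y≢b zero = y≢b
  alternate-≢-other x≢b y≢b (suc i) = alternate-≢-other y≢b x≢b i

  glue : A → A → ℕ → (ℕ → A) → ℕ → A
  glue a b d mid zero = a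
  glue a b d mid (suc i) with suc i ≟ d
  ... | yes _ = b
  ... | no _ = mid (suc i)

  module _ {a b : A} {mid : ℕ → A} where

    glue-end : 1 ≤ d → glue a b d mid d ≡ b
    glue-end {suc d} _ with suc d ≟ suc d
    ... | yes _ = refl
    ... | no d≢d = contradiction refl d≢d

    glue-interior : 1 ≤ i → i < d → glue a b d mid i ≡ mid i
    glue-interior {suc i} {d} _ i<d with suc i ≟ d
    ... | yes refl = contradiction i<d (<-irrefl refl)
    ... | no _ = refl

    glue-sequence : 2 ≤ d → a ≢ mid 1 →
                    (∀ i → 1 ≤ i → suc i < d → mid i ≢ mid (suc i)) →
                    (∀ i → suc i ≡ d → mid i ≢ b) → ProperSequence a b d
    glue-sequence {d} 2≤d a≢mid₁ consecutive before-end =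
      glue a b d mid , refl , glue-end (≤-trans (n≤1+n 1) 2≤d) , proper
      where
      proper : ∀ i → i < d → glue a b d mid i ≢ glue a b d mid (suc i)
      proper zero _ = subst (a ≢_) (≡-sym (glue-interior (s≤s z≤n) 2≤d)) a≢mid₁
      proper (suc i) 1+i<d with m≤n⇒m<n∨m≡n 1+i<d
      ... | inj₂ refl = subst₂ _≢_ (≡-sym (glue-interior (s≤s z≤n) 1+i<d))
                          (≡-sym (glue-end {d = suc (suc i)} (s≤s z≤n)))
                          (before-end (suc i) refl)
      ... | inj₁ 2+i<d = subst₂ _≢_ (≡-sym (glue-interior (s≤s z≤n) 1+i<d))
                           (≡-sym (glue-interior (s≤s z≤n) 2+i<d))
                           (consecutive (suc i) (s≤s z≤n) 2+i<d)

parity-sequence : ∀ {a b} → a ⊕ parity L ≡ b → ProperSequence a b L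
parity-sequence {a = a} arrives = (λ i → a ⊕ parity i) , refl , arrives , proper
  where
  proper : ∀ i → _ → a ⊕ parity i ≢ a ⊕ parity (suc i)
  proper i _ same =
    ⊕-⁻¹-≢ a (parity i) (trans (cong (a ⊕_) (≡-sym (parity-suc i))) (≡-sym same))

avoid : (a b : Fin (3 + k)) → ∃ λ x → x ≢ a × x ≢ b
avoid zero zero = suc zero , (λ ()) , (λ ())
avoid zero (suc zero) = suc (suc zero) , (λ ()) , (λ ())
avoid zero (suc (suc _)) = suc zero , (λ ()) , (λ ())
avoid (suc zero) zero = suc (suc zero) , (λ ()) , (λ ())
avoid (suc zero) (suc zero) = zero , (λ ()) , (λ ())
avoid (suc zero) (suc (suc _)) = zero , (λ ()) , (λ ())
avoid (suc (suc _)) zero = suc zero , (λ ()) , (λ ())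
avoid (suc (suc _)) (suc zero) = zero , (λ ()) , (λ ())
avoid (suc (suc _)) (suc (suc _)) = zero , (λ ()) , (λ ())

proper-sequence : 2 ≤ L → (a b : Fin (3 + k)) → ProperSequence a b L
proper-sequence 2≤L a b =
  glue-sequence 2≤L (x≢a ∘ ≡-sym) (λ i _ _ → alternate-≢ (y≢x ∘ ≡-sym) i)
                (λ i _ → alternate-≢-other x≢b y≢b i)
  where
  x = proj₁ (avoid a b)
  x≢a = proj₁ (proj₂ (avoid a b))
  x≢b = proj₂ (proj₂ (avoid a b))
  y = proj₁ (avoid x b)
  y≢x = proj₁ (proj₂ (avoid x b))
  y≢b = proj₂ (proj₂ (avoid x b))

class : Fin (4 + k) → Fin 2
class zero = zero
class (suc zero) = zero
class (suc (suc _)) = suc zero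

pick : Fin 2 → Fin (4 + k) → Fin (4 + k)
pick zero zero = suc zero
pick zero (suc _) = zero
pick (suc zero) (suc (suc zero)) = suc (suc (suc zero))
pick (suc zero) _ = suc (suc zero)

class-pick : ∀ s (z : Fin (4 + k)) → class (pick s z) ≡ s
class-pick zero zero = refl
class-pick zero (suc _) = refl
class-pick (suc zero) zero = refl
class-pick (suc zero) (suc zero) = refl
class-pick (suc zero) (suc (suc zero)) = refl
class-pick (suc zero) (suc (suc (suc _))) = refl

pick-≢ : ∀ s (z : Fin (4 + k)) → pick s z ≢ z
pick-≢ zero zero ()
pick-≢ zero (suc _) ()
pick-≢ (suc zero) zero ()
pick-≢ (suc zero) (suc zero) ()
pick-≢ (suc zero) (suc (suc zero)) ()
pick-≢ (suc zero) (suc (suc (suc _))) ()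

class-alternating-sequence : 3 ≤ d → (a b : Fin (4 + k)) →
  Σ (ProperSequence a b d) λ (c , _) →
    ∀ i → 1 ≤ i → suc i < d → class (c i) ≢ class (c (suc i))
class-alternating-sequence {d} {k} 3≤d a b =
  glue-sequence (≤-trans (n≤1+n 2) 3≤d) (pick-≢ _ a ∘ ≡-sym)
                (λ i _ _ same → mid-classes i (cong class same)) before-end ,
  λ i 1≤i 1+i<d → subst₂ (λ p q → class p ≢ class q)
    (≡-sym (interior 1≤i (<-trans (n<1+n i) 1+i<d))) (≡-sym (interior (s≤s z≤n) 1+i<d))
    (mid-classes i)
  where
  avoided : ℕ → Fin (4 + k)
  avoided (suc zero) = a
  avoided _ = b
  mid : ℕ → Fin (4 + k)
  mid i = pick (alternate (suc zero) zero i) (avoided i)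
  interior : ∀ {i} → 1 ≤ i → i < d → glue a b d mid i ≡ mid i
  interior = glue-interior
  mid-classes : ∀ i → class (mid i) ≢ class (mid (suc i))
  mid-classes i =
    subst₂ _≢_ (≡-sym (class-pick _ _)) (≡-sym (class-pick _ _)) (alternate-≢ (λ ()) i)
  before-end : ∀ i → suc i ≡ d → mid i ≢ b
  before-end zero 1≡d = contradiction (subst (3 ≤_) (≡-sym 1≡d) 3≤d) λ { (s≤s ()) }
  before-end (suc zero) 2≡d = contradiction (subst (3 ≤_) (≡-sym 2≡d) 3≤d) λ { (s≤s (s≤s ())) }
  before-end (suc (suc i)) _ = pick-≢ _ b

module Product (n : ℕ) (H : Graph) where

  private
    K×H : Graph
    K×H = K n ×ᴳ H
    variable
      x y : Fin (size K×H)
      u v : Fin (size H)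
      a b : Fin n

  fst : Fin (size K×H) → Fin n
  fst x = proj₁ (remQuot (size H) x)

  snd : Fin (size K×H) → Fin (size H)
  snd x = proj₂ (remQuot {n} (size H) x)

  pair : Fin n → Fin (size H) → Fin (size K×H)
  pair = combine

  fst-pair : ∀ a u → fst (pair a u) ≡ a
  fst-pair a u = cong proj₁ (remQuot-combine a u)

  snd-pair : ∀ a u → snd (pair a u) ≡ u
  snd-pair a u = cong proj₂ (remQuot-combine a u)

  pair-η : pair (fst x) (snd x) ≡ x
  pair-η {x} = combine-remQuot {n} (size H) x

  product-adjacent? : (∀ u v → Dec (Adj H u v)) → ∀ x y → Dec (Adj K×H x y)
  product-adjacent? adj? x y = ¬? (fst x ≟ᶠ fst y) ×-dec adj? (snd x) (snd y)

  lift : Walk H (snd x) (snd y) L → ProperSequence (fst x) (fst y) L → Walk K×H x y L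
  lift {x} {y} t (c , c₀ , c-end , proper) =
    walk (λ i → pair (c i) (vertex t i))
         (trans (cong₂ pair c₀ (first t)) pair-η) (trans (cong₂ pair c-end (last t)) pair-η)
         λ i i<L → (λ same → proper i i<L (trans (≡-sym (fst-pair _ (vertex t i)))
                                             (trans same (fst-pair _ (vertex t (suc i)))))) ,
                   subst₂ (Adj H) (≡-sym (snd-pair (c i) _)) (≡-sym (snd-pair (c (suc i)) _))
                          (edge t i i<L)

  project : Walk K×H x y L → Walk H (snd x) (snd y) L
  project t = walk (λ i → snd (vertex t i)) (cong snd (first t)) (cong snd (last t))
                   (λ i i<L → proj₂ (edge t i i<L))

  product-incomplete : 2 ≤ size H → Fin n → ¬ Complete K×H
  product-incomplete (s≤s (s≤s _)) a complete =
    proj₁ (complete (pair a zero) (pair a one) distinct)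
          (trans (fst-pair a zero) (≡-sym (fst-pair a one)))
    where
    one = punchIn zero zero
    distinct : pair a zero ≢ pair a one
    distinct same = punchInᵢ≢i zero zero
      (≡-sym (trans (≡-sym (snd-pair a zero)) (trans (cong snd same) (snd-pair a one))))

  module _ (adj? : ∀ u v → Dec (Adj H u v)) where

    far-from-distant : 3 ≤ d → Dist H u v d → FarApart K×H (pair a u) (pair b v)
    far-from-distant {u = u} {v} {a} {b} 3≤d dist L p =
      ≤-trans 3≤d
        (dist≤walk adj? dist (cast (snd-pair a u) (snd-pair b v) (project (path⇒walk p))))

    far-from-open-edge : Adj H u v → ¬ (∃ λ w → Adj H u w × Adj H v w) →
                         FarApart K×H (pair a u) (pair a v)
    far-from-open-edge {u} {v} {a} uv _ zero p =
      contradiction (subst (Adj H u) (≡-sym (trans (≡-sym (snd-pair a u))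
        (trans (cong snd (walk₀⇒≡ (path⇒walk p))) (snd-pair a v)))) uv) (irrefl H)
    far-from-open-edge {u} {v} {a} _ _ 1 p =
      contradiction (trans (fst-pair a u) (≡-sym (fst-pair a v)))
                    (proj₁ (walk₁⇒adj (path⇒walk p)))
    far-from-open-edge {u} {v} {a} _ no-triangle 2 p with walk₂⇒middle (path⇒walk p)
    ... | z , (_ , uz) , (_ , zv) = contradiction
      (snd z , subst (λ w → Adj H w (snd z)) (snd-pair a u) uz ,
               Graph.sym H (subst (Adj H (snd z)) (snd-pair a v) zv))
      no-triangle
    far-from-open-edge _ _ (suc (suc (suc _))) _ = s≤s (s≤s (s≤s z≤n))

module _ {H : Graph} where

  open Product 2 H

  K₂×-walk-connected : Connected H → (∀ h → OddClosedWalk H h) →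
                       WalkConnected (K 2 ×ᴳ H)
  K₂×-walk-connected connected odd x y with connected (snd x) (snd y)
  ... | L , p with fst x ⊕ parity L ≟ᶠ fst y
  ...   | yes arrives = L , lift (path⇒walk p) (parity-sequence arrives)
  ...   | no misses with odd (snd x)
  ...     | m , loop , odd-m = m + L , lift (loop ++ path⇒walk p) (parity-sequence arrives)
    where
    parity-m+L : parity (m + L) ≡ parity L ⁻¹
    parity-m+L = trans (+-homo-+ m L) (cong (_+ℙ parity L) odd-m)
    arrives : fst x ⊕ parity (m + L) ≡ fst y
    arrives = trans (cong (fst x ⊕_) parity-m+L)
                    (fin2-≢-≢⇒≡ (⊕-⁻¹-≢ (fst x) (parity L)) misses)

  far-across-K₂ : (∀ u v → Dec (Adj H u v)) → ∀ {u v} → 2 ≤ d → Dist H u v d →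
                  FarApart (K 2 ×ᴳ H) (pair zero u) (pair (suc zero) v)
  far-across-K₂ adj? {u} {v} 2≤d dist = far
    where
    2≤length : ∀ {L} → Path (K 2 ×ᴳ H) (pair zero u) (pair (suc zero) v) L → 2 ≤ L
    2≤length p = ≤-trans 2≤d (dist≤walk adj? dist
      (cast (snd-pair zero u) (snd-pair (suc zero) v) (project (path⇒walk p))))
    far : FarApart (K 2 ×ᴳ H) (pair zero u) (pair (suc zero) v)
    far 0 p = contradiction (2≤length p) λ ()
    far 1 p = contradiction (2≤length p) λ { (s≤s ()) }
    far 2 p with walk₂⇒middle (path⇒walk p)
    ... | _ , (x≢z , _) , (z≢y , _) =
      contradiction (trans (≡-sym (fst-pair zero u))
                       (trans (fin2-≢-≢⇒≡ x≢z z≢y) (fst-pair (suc zero) v))) λ ()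
    far (suc (suc (suc _))) _ = s≤s (s≤s (s≤s z≤n))

Diam₂Triangles : Graph → Set
Diam₂Triangles H = Diam H 2 × EveryEdgeInTriangle H

walk-of-length-2 : 2 ≤ size H → Connected H → Diam₂Triangles H → ∀ u v → Walk H u v 2
walk-of-length-2 {H} two connected ((bounded , _) , triangles) u v with bounded u v
... | 0 , (p , _) , _ = let (w , uw) = neighbour two connected u in
  cast refl (walk₀⇒≡ (path⇒walk p)) (uw ◅ Graph.sym H uw ◅ stay u)
... | 1 , (p , _) , _ = let (w , uw , vw) = triangles u v (walk₁⇒adj (path⇒walk p)) in
  uw ◅ Graph.sym H vw ◅ stay v
... | 2 , (p , _) , _ = path⇒walk p
... | suc (suc (suc _)) , _ , s≤s (s≤s ())

common-neighbour? : (∀ u v → Dec (Adj H u v)) →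
                    ∀ u v → Dec (∃ λ w → Adj H u w × Adj H v w)
common-neighbour? adj? u v = any? λ w → adj? u w ×-dec adj? v w

open-edge : (∀ u v → Dec (Adj H u v)) → ¬ EveryEdgeInTriangle H →
            ∃₂ λ u v → Adj H u v × ¬ (∃ λ w → Adj H u w × Adj H v w)
open-edge {H} adj? not-all
  with any? (λ u → any? λ v → adj? u v ×-dec ¬? (common-neighbour? {H} adj? u v))
... | yes found = found
... | no none = contradiction triangles not-all
  where
  triangles : EveryEdgeInTriangle H
  triangles u v uv =
    decidable-stable (common-neighbour? {H} adj? u v) λ none′ → none (u , v , uv , none′)

module _ {H : Graph} {k : ℕ} where

  open Product (3 + k) H

  K₃₊×-walk-connected : 2 ≤ size H → Connected H → WalkConnected (K (3 + k) ×ᴳ H)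
  K₃₊×-walk-connected two connected x y
    with connected (snd x) (snd y) | neighbour two connected (snd x)
  ... | L , p | _ , a =
    2 + L , lift (a ◅ Graph.sym H a ◅ path⇒walk p) (proper-sequence (s≤s (s≤s z≤n)) _ _)

  far-pair : (∀ u v → Dec (Adj H u v)) → ∀ {D} → Diam H D → 2 ≤ D → ¬ Diam₂Triangles H →
             ∃₂ (FarApart (K (3 + k) ×ᴳ H))
  far-pair adj? {D} diam 2≤D ¬diam₂-triangles with D ≟ 2
  ... | yes refl =
    let (u , v , uv , no-triangle) = open-edge {H} adj? (¬diam₂-triangles ∘ (diam ,_))
    in pair zero u , pair zero v , far-from-open-edge adj? {a = zero} uv no-triangle
  ... | no D≢2 =
    let (u , v , dist) = proj₂ diam
    in pair zero u , pair zero v ,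
       far-from-distant adj? {a = zero} {b = zero} (≤∧≢⇒< 2≤D (D≢2 ∘ ≡-sym)) dist

module _ {H : Graph} {k : ℕ} where

  open Product (4 + k) H

  class-colouring-spv : (∀ u v → Dec (Adj H u v)) → WalkConnected (K (4 + k) ×ᴳ H) →
                        SPVColoring (K (4 + k) ×ᴳ H) (class ∘ fst)
  class-colouring-spv adj? connected =
    rerouting⇒spv (product-adjacent? adj?) (class ∘ fst) connected reroute
    where
    reroute : ∀ {x y d} → Dist (K (4 + k) ×ᴳ H) x y d → 3 ≤ d →
              Σ (Walk (K (4 + k) ×ᴳ H) x y d) (ProperInterior (class ∘ fst))
    reroute {x} {y} (p , _) 3≤d with class-alternating-sequence 3≤d (fst x) (fst y)
    ... | c , alternating =
      let t = project (path⇒walk p) in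
      lift t c , λ i 1≤i 1+i<d same → alternating i 1≤i 1+i<d
        (trans (cong class (≡-sym (fst-pair _ (vertex t i))))
               (trans same (cong class (fst-pair _ (vertex t (suc i))))))

module ProductSpvc {H : Graph} (two : 2 ≤ size H) (connected : Connected H)
                   {D : ℕ} (diam : Diam H D) (2≤D : 2 ≤ D) where

  private
    adj? : ∀ u v → Dec (Adj H u v)
    adj? = adjacent? λ u v → let (d , dist , _) = proj₁ diam u v in d , dist
    root : Fin (size H)
    root = proj₁ (proj₂ diam)
    open Levels adj? (connected⇒walk-connected connected) root

  spvc-K₂×-nonbipartite : NonBipartite H → IsSpvc (K 2 ×ᴳ H) 2
  spvc-K₂×-nonbipartite nonbipartite =
    isSpvc-2 (product-incomplete two zero) (far-across-K₂ adj? 2≤D (proj₂ (proj₂ (proj₂ diam))))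
      (fst , proper⇒spv (product-adjacent? adj?) fst connected₂ λ _ _ → proj₁)
    where
    open Product 2 H
    connected₂ = K₂×-walk-connected connected λ h →
      odd-closed-walk-transport (path⇒walk (proj₂ (connected root h)))
                                (nonbipartite⇒odd-closed-walk nonbipartite)

  spvc-K₃₊×-diam₂-triangles : ∀ {k} → Diam₂Triangles H → IsSpvc (K (3 + k) ×ᴳ H) 1
  spvc-K₃₊×-diam₂-triangles {k} diam₂-triangles =
    isSpvc-1 (product-incomplete two zero) (pair zero root)
      (_ , short-walks⇒spv (product-adjacent? adj?) (λ _ → zero) walks≤2)
    where
    open Product (3 + k) H
    walks≤2 : ∀ x y → ∃ λ L → Walk (K (3 + k) ×ᴳ H) x y L × L ≤ 2
    walks≤2 x y = 2 , lift (walk-of-length-2 two connected diam₂-triangles (snd x) (snd y))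
                           (proper-sequence ≤-refl _ _) , ≤-refl

  spvc-K₄₊×-otherwise : ∀ {k} → ¬ Diam₂Triangles H → IsSpvc (K (4 + k) ×ᴳ H) 2
  spvc-K₄₊×-otherwise {k} ¬diam₂-triangles =
    isSpvc-2 (product-incomplete two zero) (proj₂ (proj₂ far))
      (class ∘ fst , class-colouring-spv {H} adj? (K₃₊×-walk-connected {H} {suc k} two connected))
    where
    open Product (4 + k) H
    far = far-pair {H} adj? diam 2≤D ¬diam₂-triangles

  spvc-K₃₊×-acyclic : ∀ {k} → ¬ Diam₂Triangles H → ¬ HasCycle H → IsSpvc (K (3 + k) ×ᴳ H) 2
  spvc-K₃₊×-acyclic {k} ¬diam₂-triangles acyclic =
    isSpvc-2 (product-incomplete two zero) (proj₂ (proj₂ far))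
      (colour , proper⇒spv (product-adjacent? adj?) colour (K₃₊×-walk-connected two connected)
                  λ _ _ xy → level-colouring-proper (acyclic⇒levels-alternate acyclic) _ _ (proj₂ xy))
    where
    open Product (3 + k) H
    far = far-pair adj? diam 2≤D ¬diam₂-triangles
    colour : Fin (size (K (3 + k) ×ᴳ H)) → Fin 2
    colour x = zero ⊕ level (snd x)

  spvc-K₃×-bounds : ¬ Diam₂Triangles H → ∃ λ k → IsSpvc (K 3 ×ᴳ H) k × 2 ≤ k × k ≤ 3
  spvc-K₃×-bounds ¬diam₂-triangles =
    bounds (spv-colourable? (product-adjacent? adj?) connected₃ 2)
    where
    open Product 3 H
    connected₃ = K₃₊×-walk-connected two connected
    incomplete = product-incomplete two zero
    far = proj₂ (proj₂ (far-pair adj? diam 2≤D ¬diam₂-triangles))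
    bounds : Dec (SPVColorable (K 3 ×ᴳ H) 2) → ∃ λ k → IsSpvc (K 3 ×ᴳ H) k × 2 ≤ k × k ≤ 3
    bounds (yes two-colours) = 2 , isSpvc-2 incomplete far two-colours , ≤-refl , n≤1+n 2
    bounds (no no-two-colours) =
      3 , isSpvc-3 incomplete far no-two-colours
            (fst , proper⇒spv (product-adjacent? adj?) fst connected₃ λ _ _ → proj₁) ,
      n≤1+n 2 , ≤-refl

theorem6p5 : (H : Graph) → 2 ≤ size H → Connected H → (∃ λ D → Diam H D × 2 ≤ D) →
    (NonBipartite H → IsSpvc (K 2 ×ᴳ H) 2)
  × (∀ n → 4 ≤ n →
        ((Diam H 2 × EveryEdgeInTriangle H) → IsSpvc (K n ×ᴳ H) 1)
      × (¬ (Diam H 2 × EveryEdgeInTriangle H) → IsSpvc (K n ×ᴳ H) 2))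
  × (((Diam H 2 × EveryEdgeInTriangle H) → IsSpvc (K 3 ×ᴳ H) 1)
      × (¬ (Diam H 2 × EveryEdgeInTriangle H) → Tree H → IsSpvc (K 3 ×ᴳ H) 2)
      × (¬ (Diam H 2 × EveryEdgeInTriangle H) → ¬ Tree H →
           ∃ λ k → IsSpvc (K 3 ×ᴳ H) k × 2 ≤ k × k ≤ 3))
theorem6p5 H two connected (D , diam , 2≤D) =
  spvc-K₂×-nonbipartite ,
  (λ { _ (s≤s (s≤s (s≤s (s≤s {n = k} _)))) →
         spvc-K₃₊×-diam₂-triangles {suc k} , spvc-K₄₊×-otherwise {k} }) ,
  spvc-K₃₊×-diam₂-triangles {0} ,
  (λ ¬diam₂-triangles tree → spvc-K₃₊×-acyclic {0} ¬diam₂-triangles (proj₂ tree)) ,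
  (λ ¬diam₂-triangles _ → spvc-K₃×-bounds ¬diam₂-triangles)
  where
  open ProductSpvc two connected diam 2≤D
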